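{- Let $n\ge k\ge d$ be positive integers and let $f\in J_{n,k,d}\cap\mathbb{Z}[\mathbf{x}_n,\mathbf{y}_d]^{\mathfrak{S}_d}$. Then $d!\cdot f\in\mathbb{Z}[\mathbf{x}_n,\mathbf{y}_d]^{\mathfrak{S}_d}\cdot G$, the ideal of $\mathbb{Z}[\mathbf{x}_n,\mathbf{y}_d]^{\mathfrak{S}_d}$ generated by $G$.
   Context: $\mathfrak{S}_d$ permutes the $y$-variables of $\mathbb{Z}[\mathbf{x}_n,\mathbf{y}_d]$. $G\subseteq\mathbb{Z}[\mathbf{x}_n,\mathbf{y}_d]$ is the set consisting of $h_r(\mathbf{y}_d)$ for all $r>k-d$; $e_r(\mathbf{x}_n)-e_{r-1}(\mathbf{x}_n)h_1(\mathbf{y}_d)+\cdots+(-1)^rh_r(\mathbf{y}_d)$ for all $r>n-d$; and $x_i^d-x_i^{d-1}e_1(\mathbf{y}_d)+\cdots+(-1)^de_d(\mathbf{y}_d)$ for $i=1,\dots,n$. $J_{n,k,d}\subseteq\mathbb{Z}[\mathbf{x}_n,\mathbf{y}_d]$ is the ideal generated by $G$. -}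

module Defs where

open import Data.Nat using (ℕ; zero; suc) renaming (_+_ to _+ℕ_)
open import Data.Integer using (ℤ; +_; -_) renaming (_+_ to _+ℤ_; _*_ to _*ℤ_)
import Data.Integer as ℤ
import Data.Nat as ℕ
open import Data.Fin using (Fin)
open import Data.Fin.Permutation using (Permutation′; _⟨$⟩ˡ_)
open import Data.Vec using (Vec; lookup; tabulate; replicate; zipWith; updateAt)
import Data.Vec.Properties as VecP
import Data.Product.Properties as ProdP
open import Data.Product using (Σ; _×_; _,_)
open import Data.List using (List; []; _∷_; _++_; map; concatMap; foldr)
import Data.List
open import Data.List.Relation.Unary.All using (All)
open import Relation.Binary.PropositionalEquality using (_≡_)
open import Relation.Nullary using (yes; no)
open import Data.Unit using (⊤)

-- Exponent vectors for monomials x^a y^b in Z[x_1..x_n, y_1..y_d]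
Mono : ℕ → ℕ → Set
Mono n d = Vec ℕ n × Vec ℕ d

_≟M_ : ∀ {n d} → (m m′ : Mono n d) → Relation.Nullary.Dec (m ≡ m′)
_≟M_ = ProdP.≡-dec (VecP.≡-dec ℕ._≟_) (VecP.≡-dec ℕ._≟_)

-- A polynomial is a finite formal sum of terms c · monomial
Poly : ℕ → ℕ → Set
Poly n d = List (ℤ × Mono n d)

module _ {n d : ℕ} where

  coeff : Poly n d → Mono n d → ℤ
  coeff [] m = + 0
  coeff ((c , m′) ∷ p) m with m′ ≟M m
  ... | yes _ = c +ℤ coeff p m
  ... | no _  = coeff p m

  infix 4 _≈_
  _≈_ : Poly n d → Poly n d → Set
  p ≈ q = ∀ m → coeff p m ≡ coeff q m

  unitM : Mono n d
  unitM = replicate n 0 , replicate d 0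

  mulM : Mono n d → Mono n d → Mono n d
  mulM (a , b) (a′ , b′) = zipWith _+ℕ_ a a′ , zipWith _+ℕ_ b b′

  const : ℤ → Poly n d
  const c = (c , unitM) ∷ []

  0P 1P : Poly n d
  0P = []
  1P = const (+ 1)

  infixl 6 _+P_ _-P_
  infixl 7 _*P_
  _+P_ : Poly n d → Poly n d → Poly n d
  _+P_ = _++_

  negP : Poly n d → Poly n d
  negP = map (λ { (c , m) → (- c , m) })

  _-P_ : Poly n d → Poly n d → Poly n d
  p -P q = p +P negP q

  _*P_ : Poly n d → Poly n d → Poly n d
  p *P q = concatMap (λ { (c , m) → map (λ { (c′ , m′) → (c *ℤ c′ , mulM m m′) }) q }) p

  scale : ℤ → Poly n d → Poly n d
  scale c p = const c *P p

  _^P_ : Poly n d → ℕ → Poly n d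
  p ^P zero = 1P
  p ^P suc k = p *P (p ^P k)

  sumP : List (Poly n d) → Poly n d
  sumP = foldr _+P_ 0P

  signP : ℕ → Poly n d → Poly n d
  signP zero p = p
  signP (suc i) p = negP (signP i p)

  sumTo : ℕ → (ℕ → Poly n d) → Poly n d
  sumTo zero f = f 0
  sumTo (suc r) f = sumTo r f +P f (suc r)

  xv : Fin n → Poly n d
  xv i = (+ 1 , (updateAt (replicate n 0) i (λ _ → 1) , replicate d 0)) ∷ []

  yv : Fin d → Poly n d
  yv j = (+ 1 , (replicate n 0 , updateAt (replicate d 0) j (λ _ → 1))) ∷ []

  elem : ℕ → List (Poly n d) → Poly n d
  elem zero [] = 1P
  elem (suc r) [] = 0P
  elem zero (p ∷ ps) = elem zero ps
  elem (suc r) (p ∷ ps) = elem (suc r) ps +P p *P elem r ps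

  hom : ℕ → List (Poly n d) → Poly n d
  hom zero _ = 1P
  hom (suc r) [] = 0P
  hom (suc r) (p ∷ ps) = hom (suc r) ps +P p *P hom r (p ∷ ps)

  xs : List (Poly n d)
  xs = Data.List.map xv (Data.List.allFin n)

  ys : List (Poly n d)
  ys = Data.List.map yv (Data.List.allFin d)

  -- action of σ ∈ S_d permuting the y-variables (y_j ↦ y_{σ j})
  actM : Permutation′ d → Mono n d → Mono n d
  actM σ (a , b) = a , tabulate (λ j → lookup b (σ ⟨$⟩ˡ j))

  act : Permutation′ d → Poly n d → Poly n d
  act σ = map (λ { (c , m) → (c , actM σ m) })

  Symmetric : Poly n d → Set
  Symmetric f = ∀ σ → act σ f ≈ f

data InG (n k d : ℕ) : Poly n d → Set where
  genH : ∀ r → k ℕ.∸ d ℕ.< r → InG n k d (hom r ys)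
  genEH : ∀ r → n ℕ.∸ d ℕ.< r →
    InG n k d (sumTo r (λ i → signP i (elem (r ℕ.∸ i) xs *P hom i ys)))
  genX : ∀ (i : Fin n) →
    InG n k d (sumTo d (λ j → signP j ((xv i ^P (d ℕ.∸ j)) *P elem j ys)))

-- f lies in the ideal generated by G, with coefficients satisfying Coef
-- (Coef = everything: the ideal J_{n,k,d} of Z[x_n,y_d];
--  Coef = Symmetric: the ideal of Z[x_n,y_d]^{S_d} generated by G)
InIdealBy : (n k d : ℕ) → (Poly n d → Set) → Poly n d → Set
InIdealBy n k d Coef f =
  Σ (List (Poly n d × Poly n d)) λ l →
    All (λ { (a , g) → Coef a × InG n k d g }) l ×
    (f ≈ sumP (map (λ { (a , g) → a *P g }) l))

J : (n k d : ℕ) → Poly n d → Set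
J n k d = InIdealBy n k d (λ _ → ⊤)

-- Write f = Σ aᵢ gᵢ with gᵢ ∈ G. Every generator is 𝔖_d-invariant: the x-variables are
-- fixed, and h_r(y), e_r(y) are symmetric functions of y. The Reynolds operator
-- ρ(a) = Σ_{σ ∈ 𝔖_d} σ·a is additive, takes invariant values, and satisfies ρ(a g) = ρ(a) g
-- for invariant g, so ρ(f) = Σ ρ(aᵢ) gᵢ lies in the ideal of invariants generated by G;
-- and ρ(f) = d!·f because f itself is invariant.
--
-- Polynomials are unnormalised term lists compared coefficientwise. The ring laws are
-- checked through the pairing Σ c·Φ(m) of a polynomial with an arbitrary weight Φ on
-- monomials, which determines the coefficients (take Φ an indicator) and is determined by them.

module Submission where

open import Defs
open import Data.Nat using (ℕ; zero; suc; _≤_; _!; _∸_; z≤n; s≤s) renaming (_+_ to _+ℕ_)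
import Data.Nat.Properties as ℕ
open import Data.Integer using (ℤ; +_; -_) renaming (_+_ to _+ℤ_; _*_ to _*ℤ_)
import Data.Integer.Properties as ℤ
open import Data.Integer.Solver using (module +-*-Solver)
open import Data.Product using (_×_; _,_; proj₁; proj₂; map₁)
open import Data.Empty using (⊥-elim)
open import Relation.Nullary using (yes; no)
open import Relation.Binary.PropositionalEquality
  using (_≡_; _≢_; refl; sym; trans; cong; cong₂; subst; module ≡-Reasoning)
import Relation.Binary.Reasoning.Setoid as SetoidReasoning
open import Function.Bundles using (mk⇔; Injection)
open import Function.Properties.Inverse using (Inverse⇒Injection)

open import Data.List using (List; []; _∷_; _++_; map; length; allFin)
import Data.List.Properties as List
open import Data.List.Relation.Unary.All using (All; []; _∷_)
open import Data.List.Membership.Propositional using (_∈_)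
open import Data.List.Membership.Propositional.Properties using (∈-map⁺; ∈-allFin)
open import Data.List.Membership.Propositional.Properties.WithK using (unique∧set⇒bag)
import Data.List.Relation.Unary.Unique.Propositional.Properties as Unique
open import Data.List.Relation.Binary.BagAndSetEquality using (∼bag⇒↭)
open import Data.List.Relation.Binary.Permutation.Propositional as ↭ using (_↭_)
import Data.List.Relation.Binary.Permutation.Propositional.Properties as ↭

open import Data.Vec using (Vec; zipWith; replicate; lookup; tabulate; updateAt)
import Data.Vec.Properties as Vec
open import Data.Vec.Relation.Binary.Pointwise.Inductive
  using (Pointwise-≡⇒≡; zipWith-comm; zipWith-assoc; zipWith-identityˡ)
open import Data.Fin using (Fin; zero; suc; punchIn; punchOut; combine; remQuot)
import Data.Fin.Properties as Fin
open import Data.Fin.Permutation as Perm using (Permutation′; _⟨$⟩ʳ_; _⟨$⟩ˡ_; _∘ₚ_)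

open import Algebra.Bundles using (CommutativeRing)
open import Algebra.Properties.CommutativeSemigroup ℤ.+-commutativeSemigroup using (x∙yz≈y∙xz)
import Algebra.Properties.Semiring.Sum as SemiringSum
import Algebra.Solver.Ring.NaturalCoefficients.Default as NaturalCoefficients

-- Pairing polynomials with weights on monomials

module _ {n d : ℕ} where

  private
    M = Mono n d
    P = Poly n d

  pairing : P → (M → ℤ) → ℤ
  pairing []            Φ = + 0
  pairing ((c , m) ∷ p) Φ = c *ℤ Φ m +ℤ pairing p Φ

  pairing-++ : ∀ (p q : P) Φ → pairing (p ++ q) Φ ≡ pairing p Φ +ℤ pairing q Φ
  pairing-++ []            q Φ = sym (ℤ.+-identityˡ _)
  pairing-++ ((c , m) ∷ p) q Φ =
    trans (cong (c *ℤ Φ m +ℤ_) (pairing-++ p q Φ)) (sym (ℤ.+-assoc (c *ℤ Φ m) _ _))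

  pairing-negP : ∀ (p : P) Φ → pairing (negP p) Φ ≡ - pairing p Φ
  pairing-negP []            Φ = refl
  pairing-negP ((c , m) ∷ p) Φ =
    trans (cong₂ _+ℤ_ (sym (ℤ.neg-distribˡ-* c (Φ m))) (pairing-negP p Φ))
          (sym (ℤ.neg-distrib-+ (c *ℤ Φ m) _))

  pairing-congʳ : ∀ (p : P) {Φ Ψ} → (∀ m → Φ m ≡ Ψ m) → pairing p Φ ≡ pairing p Ψ
  pairing-congʳ []            Φ≗Ψ = refl
  pairing-congʳ ((c , m) ∷ p) Φ≗Ψ = cong₂ (λ x y → c *ℤ x +ℤ y) (Φ≗Ψ m) (pairing-congʳ p Φ≗Ψ)

  pairing-zeroʳ : ∀ (p : P) → pairing p (λ _ → + 0) ≡ + 0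
  pairing-zeroʳ []            = refl
  pairing-zeroʳ ((c , m) ∷ p) = cong₂ _+ℤ_ (ℤ.*-zeroʳ c) (pairing-zeroʳ p)

  pairing-+ʳ : ∀ (p : P) Φ Ψ → pairing p (λ m → Φ m +ℤ Ψ m) ≡ pairing p Φ +ℤ pairing p Ψ
  pairing-+ʳ []            Φ Ψ = refl
  pairing-+ʳ ((c , m) ∷ p) Φ Ψ =
    trans (cong (c *ℤ (Φ m +ℤ Ψ m) +ℤ_) (pairing-+ʳ p Φ Ψ)) (ring c (Φ m) (Ψ m) _ _)
    where
    open +-*-Solver
    ring : ∀ c x y u v → c *ℤ (x +ℤ y) +ℤ (u +ℤ v) ≡ (c *ℤ x +ℤ u) +ℤ (c *ℤ y +ℤ v)
    ring = solve 5 (λ c x y u v → c :* (x :+ y) :+ (u :+ v) := (c :* x :+ u) :+ (c :* y :+ v)) refl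

  pairing-*ʳ : ∀ (p : P) a Φ → pairing p (λ m → a *ℤ Φ m) ≡ a *ℤ pairing p Φ
  pairing-*ʳ []            a Φ = sym (ℤ.*-zeroʳ a)
  pairing-*ʳ ((c , m) ∷ p) a Φ =
    trans (cong (c *ℤ (a *ℤ Φ m) +ℤ_) (pairing-*ʳ p a Φ)) (ring c a (Φ m) _)
    where
    open +-*-Solver
    ring : ∀ c a x u → c *ℤ (a *ℤ x) +ℤ a *ℤ u ≡ a *ℤ (c *ℤ x +ℤ u)
    ring = solve 4 (λ c a x u → c :* (a :* x) :+ a :* u := a :* (c :* x :+ u)) refl

  pairing-swap : ∀ (p q : P) (F : M → M → ℤ) →
    pairing p (λ a → pairing q (F a)) ≡ pairing q (λ b → pairing p (λ a → F a b))
  pairing-swap []            q F = sym (pairing-zeroʳ q)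
  pairing-swap ((c , m) ∷ p) q F = begin
    c *ℤ pairing q (F m) +ℤ pairing p (λ a → pairing q (F a))
      ≡⟨ cong₂ _+ℤ_ (sym (pairing-*ʳ q c (F m))) (pairing-swap p q F) ⟩
    pairing q (λ b → c *ℤ F m b) +ℤ pairing q (λ b → pairing p (λ a → F a b))
      ≡⟨ sym (pairing-+ʳ q _ _) ⟩
    pairing q (λ b → c *ℤ F m b +ℤ pairing p (λ a → F a b)) ∎
    where open ≡-Reasoning

  pairing-*P : ∀ (p q : P) Φ → pairing (p *P q) Φ ≡ pairing p (λ a → pairing q (λ b → Φ (mulM a b)))
  pairing-*P []            q Φ = refl
  pairing-*P ((c , m) ∷ p) q Φ =
    trans (pairing-++ (map _ q) (p *P q) Φ) (cong₂ _+ℤ_ (pairing-shift q) (pairing-*P p q Φ))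
    where
    pairing-shift : ∀ q → pairing (map (λ { (c′ , m′) → (c *ℤ c′ , mulM m m′) }) q) Φ
                          ≡ c *ℤ pairing q (λ b → Φ (mulM m b))
    pairing-shift []              = sym (ℤ.*-zeroʳ c)
    pairing-shift ((c′ , m′) ∷ q) =
      trans (cong (c *ℤ c′ *ℤ Φ (mulM m m′) +ℤ_) (pairing-shift q)) (ring c c′ _ _)
      where
      open +-*-Solver
      ring : ∀ c x y u → c *ℤ x *ℤ y +ℤ c *ℤ u ≡ c *ℤ (x *ℤ y +ℤ u)
      ring = solve 4 (λ c x y u → c :* x :* y :+ c :* u := c :* (x :* y :+ u)) refl

  indicator : M → M → ℤ
  indicator m m′ with m′ ≟M m
  ... | yes _ = + 1
  ... | no  _ = + 0

  coeff-as-pairing : ∀ (p : P) m → coeff p m ≡ pairing p (indicator m)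
  coeff-as-pairing []             m = refl
  coeff-as-pairing ((c , m′) ∷ p) m with m′ ≟M m
  ... | yes _ = cong₂ _+ℤ_ (sym (ℤ.*-identityʳ c)) (coeff-as-pairing p m)
  ... | no  _ = trans (coeff-as-pairing p m) (sym (trans (cong (_+ℤ _) (ℤ.*-zeroʳ c)) (ℤ.+-identityˡ _)))

  ≈-by-pairing : ∀ {p q : P} → (∀ Φ → pairing p Φ ≡ pairing q Φ) → p ≈ q
  ≈-by-pairing {p} {q} h m =
    trans (coeff-as-pairing p m) (trans (h (indicator m)) (sym (coeff-as-pairing q m)))

  coeff-++ : ∀ (p q : P) m → coeff (p ++ q) m ≡ coeff p m +ℤ coeff q m
  coeff-++ []             q m = sym (ℤ.+-identityˡ _)
  coeff-++ ((c , m′) ∷ p) q m with m′ ≟M m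
  ... | yes _ = trans (cong (c +ℤ_) (coeff-++ p q m)) (sym (ℤ.+-assoc c _ _))
  ... | no  _ = coeff-++ p q m

  coeff-negP : ∀ (p : P) m → coeff (negP p) m ≡ - coeff p m
  coeff-negP []             m = refl
  coeff-negP ((c , m′) ∷ p) m with m′ ≟M m
  ... | yes _ = trans (cong (- c +ℤ_) (coeff-negP p m)) (sym (ℤ.neg-distrib-+ c _))
  ... | no  _ = coeff-negP p m

  erase : M → P → P
  erase m₀ []             = []
  erase m₀ ((c , m) ∷ p) with m ≟M m₀
  ... | yes _ = erase m₀ p
  ... | no  _ = (c , m) ∷ erase m₀ p

  pairing-erase : ∀ m₀ (p : P) Φ → pairing p Φ ≡ coeff p m₀ *ℤ Φ m₀ +ℤ pairing (erase m₀ p) Φ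
  pairing-erase m₀ []            Φ = refl
  pairing-erase m₀ ((c , m) ∷ p) Φ with m ≟M m₀
  ... | yes refl = trans (cong (c *ℤ Φ m +ℤ_) (pairing-erase m₀ p Φ)) (ring c (coeff p m) (Φ m) _)
    where
    open +-*-Solver
    ring : ∀ c k x u → c *ℤ x +ℤ (k *ℤ x +ℤ u) ≡ (c +ℤ k) *ℤ x +ℤ u
    ring = solve 4 (λ c k x u → c :* x :+ (k :* x :+ u) := (c :+ k) :* x :+ u) refl
  ... | no _ = trans (cong (c *ℤ Φ m +ℤ_) (pairing-erase m₀ p Φ)) (x∙yz≈y∙xz (c *ℤ Φ m) (coeff p m₀ *ℤ Φ m₀) _)

  coeff-erase-self : ∀ m₀ (p : P) → coeff (erase m₀ p) m₀ ≡ + 0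
  coeff-erase-self m₀ []            = refl
  coeff-erase-self m₀ ((c , m) ∷ p) with m ≟M m₀
  ... | yes _   = coeff-erase-self m₀ p
  ... | no m≢m₀ with m ≟M m₀
  ...   | yes m≡m₀ = ⊥-elim (m≢m₀ m≡m₀)
  ...   | no  _    = coeff-erase-self m₀ p

  coeff-erase-other : ∀ {m₀ m₁} (p : P) → m₀ ≢ m₁ → coeff (erase m₀ p) m₁ ≡ coeff p m₁
  coeff-erase-other []            m₀≢m₁ = refl
  coeff-erase-other {m₀} {m₁} ((c , m) ∷ p) m₀≢m₁ with m ≟M m₀
  ... | yes refl with m ≟M m₁
  ...   | yes m≡m₁ = ⊥-elim (m₀≢m₁ m≡m₁)
  ...   | no  _    = coeff-erase-other p m₀≢m₁
  coeff-erase-other {m₀} {m₁} ((c , m) ∷ p) m₀≢m₁ | no _ with m ≟M m₁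
  ...   | yes _ = cong (c +ℤ_) (coeff-erase-other p m₀≢m₁)
  ...   | no  _ = coeff-erase-other p m₀≢m₁

  length-erase : ∀ m₀ (p : P) → length (erase m₀ p) ≤ length p
  length-erase m₀ []            = z≤n
  length-erase m₀ ((c , m) ∷ p) with m ≟M m₀
  ... | yes _ = ℕ.m≤n⇒m≤1+n (length-erase m₀ p)
  ... | no  _ = s≤s (length-erase m₀ p)

  length-erase-head : ∀ m₀ c (p : P) → length (erase m₀ ((c , m₀) ∷ p)) ≤ length p
  length-erase-head m₀ c p with m₀ ≟M m₀
  ... | yes _     = length-erase m₀ p
  ... | no  m₀≢m₀ = ⊥-elim (m₀≢m₀ refl)

  pairing-null : ∀ (p : P) → (∀ m → coeff p m ≡ + 0) → ∀ Φ → pairing p Φ ≡ + 0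
  pairing-null p = go (length p) p ℕ.≤-refl
    where
    -- erase is not structurally smaller, so the recursion is on a bound for the length.
    go : ∀ bound (p : P) → length p ≤ bound → (∀ m → coeff p m ≡ + 0) → ∀ Φ → pairing p Φ ≡ + 0
    go _           []             _          _      Φ = refl
    go (suc bound) ((c , m₀) ∷ p) (s≤s |p|≤) p-null Φ = begin
      pairing ((c , m₀) ∷ p) Φ
        ≡⟨ pairing-erase m₀ ((c , m₀) ∷ p) Φ ⟩
      coeff ((c , m₀) ∷ p) m₀ *ℤ Φ m₀ +ℤ pairing p′ Φ
        ≡⟨ cong₂ (λ a b → a *ℤ Φ m₀ +ℤ b) (p-null m₀) (go bound p′ p′≤ p′-null Φ) ⟩
      + 0 ∎
      where
      open ≡-Reasoning
      p′ = erase m₀ ((c , m₀) ∷ p)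
      p′≤ : length p′ ≤ bound
      p′≤ = ℕ.≤-trans (length-erase-head m₀ c p) |p|≤
      p′-null : ∀ m → coeff p′ m ≡ + 0
      p′-null m with m₀ ≟M m
      ... | yes refl  = coeff-erase-self m₀ ((c , m₀) ∷ p)
      ... | no  m₀≢m = trans (coeff-erase-other ((c , m₀) ∷ p) m₀≢m) (p-null m)

  pairing-resp-≈ : ∀ {p q : P} → p ≈ q → ∀ Φ → pairing p Φ ≡ pairing q Φ
  pairing-resp-≈ {p} {q} p≈q Φ = ℤ.i-j≡0⇒i≡j _ _ (begin
    pairing p Φ +ℤ - pairing q Φ       ≡⟨ cong (pairing p Φ +ℤ_) (pairing-negP q Φ) ⟨
    pairing p Φ +ℤ pairing (negP q) Φ  ≡⟨ pairing-++ p (negP q) Φ ⟨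
    pairing (p -P q) Φ                 ≡⟨ pairing-null (p -P q) p-q-null Φ ⟩
    + 0                                ∎)
    where
    open ≡-Reasoning
    p-q-null : ∀ m → coeff (p -P q) m ≡ + 0
    p-q-null m = begin
      coeff (p -P q) m              ≡⟨ coeff-++ p (negP q) m ⟩
      coeff p m +ℤ coeff (negP q) m ≡⟨ cong₂ _+ℤ_ (p≈q m) (coeff-negP q m) ⟩
      coeff q m +ℤ - coeff q m      ≡⟨ ℤ.+-inverseʳ (coeff q m) ⟩
      + 0                           ∎

-- The commutative ring of polynomials

module _ {k : ℕ} where

  zipWith-+-comm : ∀ (u v : Vec ℕ k) → zipWith _+ℕ_ u v ≡ zipWith _+ℕ_ v u
  zipWith-+-comm u v = Pointwise-≡⇒≡ (zipWith-comm ℕ.+-comm u v)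

  zipWith-+-assoc : ∀ (u v w : Vec ℕ k) →
    zipWith _+ℕ_ (zipWith _+ℕ_ u v) w ≡ zipWith _+ℕ_ u (zipWith _+ℕ_ v w)
  zipWith-+-assoc u v w = Pointwise-≡⇒≡ (zipWith-assoc ℕ.+-assoc u v w)

  zipWith-+-identityˡ : ∀ (u : Vec ℕ k) → zipWith _+ℕ_ (replicate k 0) u ≡ u
  zipWith-+-identityˡ u = Pointwise-≡⇒≡ (zipWith-identityˡ ℕ.+-identityˡ u)

module _ {n d : ℕ} where

  private
    M = Mono n d

  mulM-comm : ∀ (a b : M) → mulM a b ≡ mulM b a
  mulM-comm (a , b) (a′ , b′) = cong₂ _,_ (zipWith-+-comm a a′) (zipWith-+-comm b b′)

  mulM-assoc : ∀ (a b c : M) → mulM (mulM a b) c ≡ mulM a (mulM b c)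
  mulM-assoc (a , b) (a′ , b′) (a″ , b″) = cong₂ _,_ (zipWith-+-assoc a a′ a″) (zipWith-+-assoc b b′ b″)

  mulM-identityˡ : ∀ (a : M) → mulM unitM a ≡ a
  mulM-identityˡ (a , b) = cong₂ _,_ (zipWith-+-identityˡ a) (zipWith-+-identityˡ b)

-- A data type rather than the function type _≈_, so that both polynomials can be
-- inferred from a proof (as setoid reasoning and the ring solver require).
infix 4 _≋_
record _≋_ {n d} (p q : Poly n d) : Set where
  constructor mk≋
  field ≋⇒≈ : p ≈ q
open _≋_

module _ {n d : ℕ} where

  private
    P = Poly n d

  ≋-by-pairing : ∀ {p q : P} → (∀ Φ → pairing p Φ ≡ pairing q Φ) → p ≋ q
  ≋-by-pairing {p} {q} h = mk≋ (≈-by-pairing {p = p} {q} h)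

  ≡⇒≋ : ∀ {p q : P} → p ≡ q → p ≋ q
  ≡⇒≋ refl = mk≋ λ _ → refl

  ≋-refl : ∀ {p : P} → p ≋ p
  ≋-refl = mk≋ λ _ → refl

  ≋-sym : ∀ {p q : P} → p ≋ q → q ≋ p
  ≋-sym (mk≋ p≈q) = mk≋ λ m → sym (p≈q m)

  ≋-trans : ∀ {p q r : P} → p ≋ q → q ≋ r → p ≋ r
  ≋-trans (mk≋ p≈q) (mk≋ q≈r) = mk≋ λ m → trans (p≈q m) (q≈r m)

  +P-cong : ∀ {p p′ q q′ : P} → p ≋ p′ → q ≋ q′ → p +P q ≋ p′ +P q′
  +P-cong {p} {p′} {q} {q′} (mk≋ p≈p′) (mk≋ q≈q′) = mk≋ λ m →
    trans (coeff-++ p q m) (trans (cong₂ _+ℤ_ (p≈p′ m) (q≈q′ m)) (sym (coeff-++ p′ q′ m)))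

  negP-cong : ∀ {p q : P} → p ≋ q → negP p ≋ negP q
  negP-cong {p} {q} (mk≋ p≈q) = mk≋ λ m →
    trans (coeff-negP p m) (trans (cong -_ (p≈q m)) (sym (coeff-negP q m)))

  *P-cong : ∀ {p p′ q q′ : P} → p ≋ p′ → q ≋ q′ → p *P q ≋ p′ *P q′
  *P-cong {p} {p′} {q} {q′} (mk≋ p≈p′) (mk≋ q≈q′) = ≋-by-pairing λ Φ → begin
    pairing (p *P q) Φ                                        ≡⟨ pairing-*P p q Φ ⟩
    pairing p (λ a → pairing q (λ b → Φ (mulM a b)))          ≡⟨ pairing-resp-≈ {p = p} {p′} p≈p′ _ ⟩
    pairing p′ (λ a → pairing q (λ b → Φ (mulM a b)))         ≡⟨ pairing-congʳ p′ (λ a → pairing-resp-≈ {p = q} {q′} q≈q′ _) ⟩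
    pairing p′ (λ a → pairing q′ (λ b → Φ (mulM a b)))        ≡⟨ pairing-*P p′ q′ Φ ⟨
    pairing (p′ *P q′) Φ                                      ∎
    where open ≡-Reasoning

  +P-assoc : ∀ (p q r : P) → (p +P q) +P r ≋ p +P (q +P r)
  +P-assoc p q r = ≡⇒≋ (List.++-assoc p q r)

  +P-identityʳ : ∀ (p : P) → p +P 0P ≋ p
  +P-identityʳ p = ≡⇒≋ (List.++-identityʳ p)

  +P-comm : ∀ (p q : P) → p +P q ≋ q +P p
  +P-comm p q = mk≋ λ m → trans (coeff-++ p q m) (trans (ℤ.+-comm (coeff p m) (coeff q m)) (sym (coeff-++ q p m)))

  -P-inverseʳ : ∀ (p : P) → p +P negP p ≋ 0P
  -P-inverseʳ p = mk≋ λ m →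
    trans (coeff-++ p (negP p) m) (trans (cong (coeff p m +ℤ_) (coeff-negP p m)) (ℤ.+-inverseʳ (coeff p m)))

  -P-inverseˡ : ∀ (p : P) → negP p +P p ≋ 0P
  -P-inverseˡ p = ≋-trans (+P-comm (negP p) p) (-P-inverseʳ p)

  *P-comm : ∀ (p q : P) → p *P q ≋ q *P p
  *P-comm p q = ≋-by-pairing λ Φ → begin
    pairing (p *P q) Φ                                ≡⟨ pairing-*P p q Φ ⟩
    pairing p (λ a → pairing q (λ b → Φ (mulM a b)))  ≡⟨ pairing-swap p q _ ⟩
    pairing q (λ b → pairing p (λ a → Φ (mulM a b)))  ≡⟨ pairing-congʳ q (λ b → pairing-congʳ p (λ a → cong Φ (mulM-comm a b))) ⟩
    pairing q (λ b → pairing p (λ a → Φ (mulM b a)))  ≡⟨ pairing-*P q p Φ ⟨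
    pairing (q *P p) Φ                                ∎
    where open ≡-Reasoning

  *P-assoc : ∀ (p q r : P) → (p *P q) *P r ≋ p *P (q *P r)
  *P-assoc p q r = ≋-by-pairing λ Φ → begin
    pairing ((p *P q) *P r) Φ
      ≡⟨ trans (pairing-*P (p *P q) r Φ) (pairing-*P p q _) ⟩
    pairing p (λ a → pairing q (λ b → pairing r (λ c → Φ (mulM (mulM a b) c))))
      ≡⟨ pairing-congʳ p (λ a → pairing-congʳ q (λ b → pairing-congʳ r (λ c → cong Φ (mulM-assoc a b c)))) ⟩
    pairing p (λ a → pairing q (λ b → pairing r (λ c → Φ (mulM a (mulM b c)))))
      ≡⟨ pairing-congʳ p (λ a → pairing-*P q r _) ⟨
    pairing p (λ a → pairing (q *P r) (λ bc → Φ (mulM a bc)))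
      ≡⟨ pairing-*P p (q *P r) Φ ⟨
    pairing (p *P (q *P r)) Φ ∎
    where open ≡-Reasoning

  *P-identityˡ : ∀ (p : P) → 1P *P p ≋ p
  *P-identityˡ p = ≋-by-pairing λ Φ → begin
    pairing (1P *P p) Φ                            ≡⟨ pairing-*P 1P p Φ ⟩
    + 1 *ℤ pairing p (λ b → Φ (mulM unitM b)) +ℤ + 0 ≡⟨ trans (ℤ.+-identityʳ _) (ℤ.*-identityˡ _) ⟩
    pairing p (λ b → Φ (mulM unitM b))             ≡⟨ pairing-congʳ p (λ b → cong Φ (mulM-identityˡ b)) ⟩
    pairing p Φ                                    ∎
    where open ≡-Reasoning

  *P-identityʳ : ∀ (p : P) → p *P 1P ≋ p
  *P-identityʳ p = ≋-trans (*P-comm p 1P) (*P-identityˡ p)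

  *P-distribʳ-+P : ∀ (r p q : P) → (p +P q) *P r ≋ p *P r +P q *P r
  *P-distribʳ-+P r p q = ≡⇒≋ (List.concatMap-++ _ p q)

  *P-distribˡ-+P : ∀ (r p q : P) → r *P (p +P q) ≋ r *P p +P r *P q
  *P-distribˡ-+P r p q = ≋-trans (*P-comm r (p +P q))
    (≋-trans (*P-distribʳ-+P r p q) (+P-cong (*P-comm p r) (*P-comm q r)))

polyRing : ∀ n d → CommutativeRing _ _
polyRing n d = record
  { Carrier = Poly n d ; _≈_ = _≋_ ; _+_ = _+P_ ; _*_ = _*P_ ; -_ = negP ; 0# = 0P ; 1# = 1P
  ; isCommutativeRing = record
    { isRing = record
      { +-isAbelianGroup = record
        { isGroup = record
          { isMonoid = record
            { isSemigroup = record
              { isMagma = record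
                { isEquivalence = record { refl = ≋-refl ; sym = ≋-sym ; trans = ≋-trans }
                ; ∙-cong = +P-cong }
              ; assoc = +P-assoc }
            ; identity = (λ _ → ≋-refl) , +P-identityʳ }
          ; inverse = -P-inverseˡ , -P-inverseʳ
          ; ⁻¹-cong = negP-cong }
        ; comm = +P-comm }
      ; *-cong = *P-cong
      ; *-assoc = *P-assoc
      ; *-identity = *P-identityˡ , *P-identityʳ
      ; distrib = *P-distribˡ-+P , *P-distribʳ-+P }
    ; *-comm = *P-comm } }

-- e_r and h_r are invariant under permuting their arguments

module _ {n d : ℕ} where

  private
    P = Poly n d
    module R = CommutativeRing (polyRing n d)
    open NaturalCoefficients R.commutativeSemiring using (solve; _:=_; _:+_; _:*_)

  ↭-invariant : (F : ℕ → List P → P) →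
    (∀ x {L L′} → (∀ s → F s L ≋ F s L′) → ∀ r → F r (x ∷ L) ≋ F r (x ∷ L′)) →
    (∀ r x y L → F r (x ∷ y ∷ L) ≋ F r (y ∷ x ∷ L)) →
    ∀ {L L′} → L ↭ L′ → ∀ r → F r L ≋ F r L′
  ↭-invariant F F-prep F-swap ↭.refl           r = R.refl
  ↭-invariant F F-prep F-swap (↭.prep x L↭L′)  r = F-prep x (↭-invariant F F-prep F-swap L↭L′) r
  ↭-invariant F F-prep F-swap (↭.swap {xs} x y L↭L′) r =
    R.trans (F-swap r x y xs) (F-prep y (F-prep x (↭-invariant F F-prep F-swap L↭L′)) r)
  ↭-invariant F F-prep F-swap (↭.trans L↭L′ L′↭L″) r =
    R.trans (↭-invariant F F-prep F-swap L↭L′ r) (↭-invariant F F-prep F-swap L′↭L″ r)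

  elem-↭ : ∀ {L L′ : List P} → L ↭ L′ → ∀ r → elem r L ≋ elem r L′
  elem-↭ = ↭-invariant elem elem-prep elem-swap
    where
    elem-prep : ∀ x {L L′} → (∀ s → elem s L ≋ elem s L′) → ∀ r → elem r (x ∷ L) ≋ elem r (x ∷ L′)
    elem-prep x e zero    = e zero
    elem-prep x e (suc r) = R.+-cong (e (suc r)) (R.*-congˡ {x} (e r))
    elem-swap : ∀ r x y L → elem r (x ∷ y ∷ L) ≋ elem r (y ∷ x ∷ L)
    elem-swap zero          x y L = R.refl
    elem-swap (suc zero)    x y L =
      solve 4 (λ e₁ e₀ x y → (e₁ :+ y :* e₀) :+ x :* e₀ := (e₁ :+ x :* e₀) :+ y :* e₀) R.refl
        (elem 1 L) (elem 0 L) x y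
    elem-swap (suc (suc r)) x y L =
      solve 5 (λ e₂ e₁ e₀ x y → (e₂ :+ y :* e₁) :+ x :* (e₁ :+ y :* e₀) := (e₂ :+ x :* e₁) :+ y :* (e₁ :+ x :* e₀)) R.refl
        (elem (suc (suc r)) L) (elem (suc r) L) (elem r L) x y

  hom-↭ : ∀ {L L′ : List P} → L ↭ L′ → ∀ r → hom r L ≋ hom r L′
  hom-↭ = ↭-invariant hom hom-prep hom-swap
    where
    hom-prep : ∀ x {L L′} → (∀ s → hom s L ≋ hom s L′) → ∀ r → hom r (x ∷ L) ≋ hom r (x ∷ L′)
    hom-prep x e zero    = R.refl
    hom-prep x e (suc r) = R.+-cong (e (suc r)) (R.*-congˡ {x} (hom-prep x e r))
    hom-exchange : ∀ r x y L →
      hom (suc r) (y ∷ L) +P x *P hom r (x ∷ y ∷ L) ≋ hom (suc r) (x ∷ L) +P y *P hom r (x ∷ y ∷ L)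
    hom-exchange zero x y L =
      solve 4 (λ h₁ h₀ x y → (h₁ :+ y :* h₀) :+ x :* h₀ := (h₁ :+ x :* h₀) :+ y :* h₀) R.refl
        (hom 1 L) 1P x y
    hom-exchange (suc r) x y L = begin
      (H +P y *P Hy) +P x *P (Hy +P x *P A) ≈⟨ R.+-congˡ (R.*-congˡ {x} (hom-exchange r x y L)) ⟩
      (H +P y *P Hy) +P x *P (Hx +P y *P A)
        ≈⟨ solve 6 (λ H Hx Hy A x y → (H :+ y :* Hy) :+ x :* (Hx :+ y :* A) := (H :+ x :* Hx) :+ y :* (Hy :+ x :* A))
                   R.refl H Hx Hy A x y ⟩
      (H +P x *P Hx) +P y *P (Hy +P x *P A) ∎
      where
      open SetoidReasoning R.setoid
      H  = hom (suc (suc r)) L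
      Hx = hom (suc r) (x ∷ L)
      Hy = hom (suc r) (y ∷ L)
      A  = hom r (x ∷ y ∷ L)
    hom-swap : ∀ r x y L → hom r (x ∷ y ∷ L) ≋ hom r (y ∷ x ∷ L)
    hom-swap zero    x y L = R.refl
    hom-swap (suc r) x y L = R.trans (hom-exchange r x y L) (R.+-congˡ (R.*-congˡ {y} (hom-swap r x y L)))

-- The action of 𝔖_d

lookup-ext : ∀ {A : Set} {k} {u v : Vec A k} → (∀ i → lookup u i ≡ lookup v i) → u ≡ v
lookup-ext {u = u} {v} h = trans (sym (Vec.tabulate∘lookup u)) (trans (Vec.tabulate-cong h) (Vec.tabulate∘lookup v))

map-allFin-↭ : ∀ {k} (π : Permutation′ k) → map (π ⟨$⟩ʳ_) (allFin k) ↭ allFin k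
map-allFin-↭ {k} π = ∼bag⇒↭ (unique∧set⇒bag
  (Unique.map⁺ (Injection.injective (Inverse⇒Injection π)) (Unique.allFin⁺ k))
  (Unique.allFin⁺ k)
  (mk⇔ (λ _ → ∈-allFin _) in-image))
  where
  in-image : ∀ {i} → i ∈ allFin k → i ∈ map (π ⟨$⟩ʳ_) (allFin k)
  in-image {i} _ = subst (_∈ map (π ⟨$⟩ʳ_) (allFin k)) (Perm.inverseʳ π) (∈-map⁺ (π ⟨$⟩ʳ_) (∈-allFin (π ⟨$⟩ˡ i)))

module _ {n d : ℕ} where

  private
    M = Mono n d
    P = Poly n d

  actM-mulM : ∀ σ (a b : M) → actM σ (mulM a b) ≡ mulM (actM σ a) (actM σ b)
  actM-mulM σ (a , b) (a′ , b′) = cong (zipWith _+ℕ_ a a′ ,_) (lookup-ext λ j → begin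
    lookup (tabulate (λ i → lookup (zipWith _+ℕ_ b b′) (σ ⟨$⟩ˡ i))) j ≡⟨ Vec.lookup∘tabulate _ j ⟩
    lookup (zipWith _+ℕ_ b b′) (σ ⟨$⟩ˡ j)                             ≡⟨ Vec.lookup-zipWith _+ℕ_ (σ ⟨$⟩ˡ j) b b′ ⟩
    lookup b (σ ⟨$⟩ˡ j) +ℕ lookup b′ (σ ⟨$⟩ˡ j)                      ≡⟨ cong₂ _+ℕ_ (Vec.lookup∘tabulate _ j) (Vec.lookup∘tabulate _ j) ⟨
    lookup σb j +ℕ lookup σb′ j                                       ≡⟨ Vec.lookup-zipWith _+ℕ_ j σb σb′ ⟨
    lookup (zipWith _+ℕ_ σb σb′) j                                    ∎)
    where
    open ≡-Reasoning
    σb σb′ : Vec ℕ d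
    σb  = tabulate (λ i → lookup b (σ ⟨$⟩ˡ i))
    σb′ = tabulate (λ i → lookup b′ (σ ⟨$⟩ˡ i))

  actM-pureˣ : ∀ σ (a : Vec ℕ n) → actM σ (a , replicate d 0) ≡ (a , replicate d 0)
  actM-pureˣ σ a = cong (a ,_) (lookup-ext λ j →
    trans (Vec.lookup∘tabulate _ j) (trans (Vec.lookup-replicate (σ ⟨$⟩ˡ j) 0) (sym (Vec.lookup-replicate j 0))))

  actM-∘ₚ : ∀ σ τ (m : M) → actM τ (actM σ m) ≡ actM (σ ∘ₚ τ) m
  actM-∘ₚ σ τ (a , b) = cong (a ,_) (Vec.tabulate-cong λ j → Vec.lookup∘tabulate _ (τ ⟨$⟩ˡ j))

  ⟨$⟩ˡ-cong : ∀ {k} {σ τ : Permutation′ k} → σ Perm.≈ τ → ∀ i → σ ⟨$⟩ˡ i ≡ τ ⟨$⟩ˡ i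
  ⟨$⟩ˡ-cong {σ = σ} {τ} σ≈τ i =
    trans (sym (Perm.inverseˡ τ)) (cong (τ ⟨$⟩ˡ_) (trans (sym (σ≈τ (σ ⟨$⟩ˡ i))) (Perm.inverseʳ σ)))

  actM-cong : ∀ {σ τ} → σ Perm.≈ τ → (m : M) → actM σ m ≡ actM τ m
  actM-cong {σ} {τ} σ≈τ (a , b) = cong (a ,_) (Vec.tabulate-cong λ j → cong (lookup b) (⟨$⟩ˡ-cong {σ = σ} {τ} σ≈τ j))

  act-++ : ∀ σ (p q : P) → act σ (p ++ q) ≡ act σ p ++ act σ q
  act-++ σ p q = List.map-++ _ p q

  act-negP : ∀ σ (p : P) → act σ (negP p) ≡ negP (act σ p)
  act-negP σ []            = refl
  act-negP σ ((c , m) ∷ p) = cong (_ ∷_) (act-negP σ p)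

  act-*P : ∀ σ (p q : P) → act σ (p *P q) ≡ act σ p *P act σ q
  act-*P σ []            q = refl
  act-*P σ ((c , m) ∷ p) q =
    trans (act-++ σ (map _ q) (p *P q)) (cong₂ _++_ (act-shift q) (act-*P σ p q))
    where
    act-shift : ∀ q → act σ (map (λ { (c′ , m′) → (c *ℤ c′ , mulM m m′) }) q)
                      ≡ map (λ { (c′ , m′) → (c *ℤ c′ , mulM (actM σ m) m′) }) (act σ q)
    act-shift []              = refl
    act-shift ((c′ , m′) ∷ q) = cong₂ _∷_ (cong (c *ℤ c′ ,_) (actM-mulM σ m m′)) (act-shift q)

  act-1P : ∀ σ → act σ (1P {n} {d}) ≡ 1P
  act-1P σ = cong (λ m → (+ 1 , m) ∷ []) (actM-pureˣ σ (replicate n 0))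

  act-∘ₚ : ∀ σ τ (p : P) → act τ (act σ p) ≡ act (σ ∘ₚ τ) p
  act-∘ₚ σ τ p = trans (sym (List.map-∘ p)) (List.map-cong (λ { (c , m) → cong (c ,_) (actM-∘ₚ σ τ m) }) p)

  act-cong : ∀ {σ τ} → σ Perm.≈ τ → (p : P) → act σ p ≡ act τ p
  act-cong {σ} {τ} σ≈τ = List.map-cong λ { (c , m) → cong (c ,_) (actM-cong {σ} {τ} σ≈τ m) }

  pairing-act : ∀ σ (p : P) Φ → pairing (act σ p) Φ ≡ pairing p (λ m → Φ (actM σ m))
  pairing-act σ []            Φ = refl
  pairing-act σ ((c , m) ∷ p) Φ = cong (c *ℤ Φ (actM σ m) +ℤ_) (pairing-act σ p Φ)

  act-resp-≋ : ∀ σ {p q : P} → p ≋ q → act σ p ≋ act σ q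
  act-resp-≋ σ {p} {q} (mk≋ p≈q) = ≋-by-pairing λ Φ →
    trans (pairing-act σ p Φ) (trans (pairing-resp-≈ {p = p} {q} p≈q _) (sym (pairing-act σ q Φ)))

  act-elem : ∀ σ r (L : List P) → act σ (elem r L) ≡ elem r (map (act σ) L)
  act-elem σ zero    []      = act-1P σ
  act-elem σ (suc r) []      = refl
  act-elem σ zero    (p ∷ L) = act-elem σ zero L
  act-elem σ (suc r) (p ∷ L) = trans (act-++ σ (elem (suc r) L) (p *P elem r L))
    (cong₂ _++_ (act-elem σ (suc r) L) (trans (act-*P σ p (elem r L)) (cong (act σ p *P_) (act-elem σ r L))))

  act-hom : ∀ σ r (L : List P) → act σ (hom r L) ≡ hom r (map (act σ) L)
  act-hom σ zero    L       = act-1P σ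
  act-hom σ (suc r) []      = refl
  act-hom σ (suc r) (p ∷ L) = trans (act-++ σ (hom (suc r) L) (p *P hom r (p ∷ L)))
    (cong₂ _++_ (act-hom σ (suc r) L) (trans (act-*P σ p (hom r (p ∷ L))) (cong (act σ p *P_) (act-hom σ r (p ∷ L)))))

  act-^P : ∀ σ (p : P) k → act σ (p ^P k) ≡ act σ p ^P k
  act-^P σ p zero    = act-1P σ
  act-^P σ p (suc k) = trans (act-*P σ p (p ^P k)) (cong (act σ p *P_) (act-^P σ p k))

  act-signP : ∀ σ i (p : P) → act σ (signP i p) ≡ signP i (act σ p)
  act-signP σ zero    p = refl
  act-signP σ (suc i) p = trans (act-negP σ (signP i p)) (cong negP (act-signP σ i p))

  act-sumTo : ∀ σ r (f : ℕ → P) → act σ (sumTo r f) ≡ sumTo r (λ i → act σ (f i))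
  act-sumTo σ zero    f = refl
  act-sumTo σ (suc r) f = trans (act-++ σ (sumTo r f) (f (suc r))) (cong (_++ act σ (f (suc r))) (act-sumTo σ r f))

  act-xv : ∀ σ (i : Fin n) → act σ (xv {n} {d} i) ≡ xv i
  act-xv σ i = cong (λ m → (+ 1 , m) ∷ []) (actM-pureˣ σ _)

  act-yv : ∀ σ (j : Fin d) → act σ (yv {n} {d} j) ≡ yv (σ ⟨$⟩ʳ j)
  act-yv σ j = cong (λ b → (+ 1 , (replicate n 0 , b)) ∷ []) (lookup-ext relabel)
    where
    unit : Fin d → Vec ℕ d
    unit j = updateAt (replicate d 0) j (λ _ → 1)
    σunit : Vec ℕ d
    σunit = tabulate (λ i → lookup (unit j) (σ ⟨$⟩ˡ i))
    relabel : ∀ i → lookup σunit i ≡ lookup (unit (σ ⟨$⟩ʳ j)) i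
    relabel i with σ ⟨$⟩ʳ j Fin.≟ i
    ... | yes refl = begin
      lookup σunit (σ ⟨$⟩ʳ j)                                           ≡⟨ Vec.lookup∘tabulate (λ i → lookup (unit j) (σ ⟨$⟩ˡ i)) (σ ⟨$⟩ʳ j) ⟩
      lookup (unit j) (σ ⟨$⟩ˡ (σ ⟨$⟩ʳ j))                              ≡⟨ cong (lookup (unit j)) (Perm.inverseˡ σ) ⟩
      lookup (unit j) j                                                 ≡⟨ Vec.lookup∘updateAt j (replicate d 0) ⟩
      1                                                                 ≡⟨ Vec.lookup∘updateAt (σ ⟨$⟩ʳ j) (replicate d 0) ⟨
      lookup (unit (σ ⟨$⟩ʳ j)) (σ ⟨$⟩ʳ j)                              ∎
      where open ≡-Reasoning
    ... | no σj≢i = begin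
      lookup σunit i                                         ≡⟨ Vec.lookup∘tabulate (λ i → lookup (unit j) (σ ⟨$⟩ˡ i)) i ⟩
      lookup (unit j) (σ ⟨$⟩ˡ i)                             ≡⟨ Vec.lookup∘updateAt′ (σ ⟨$⟩ˡ i) j σˡi≢j (replicate d 0) ⟩
      lookup (replicate d 0) (σ ⟨$⟩ˡ i)                      ≡⟨ Vec.lookup-replicate (σ ⟨$⟩ˡ i) 0 ⟩
      0                                                      ≡⟨ Vec.lookup-replicate i 0 ⟨
      lookup (replicate d 0) i                               ≡⟨ Vec.lookup∘updateAt′ i (σ ⟨$⟩ʳ j) (λ i≡σj → σj≢i (sym i≡σj)) (replicate d 0) ⟨
      lookup (unit (σ ⟨$⟩ʳ j)) i                             ∎
      where
      open ≡-Reasoning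
      σˡi≢j : σ ⟨$⟩ˡ i ≢ j
      σˡi≢j σˡi≡j = σj≢i (trans (cong (σ ⟨$⟩ʳ_) (sym σˡi≡j)) (Perm.inverseʳ σ))

  act-xs : ∀ σ → map (act σ) (xs {n} {d}) ≡ xs
  act-xs σ = trans (sym (List.map-∘ (allFin n))) (List.map-cong (act-xv σ) (allFin n))

  act-ys : ∀ σ → map (act σ) (ys {n} {d}) ↭ ys
  act-ys σ = subst (_↭ ys) (sym relabel) (↭.map⁺ yv (map-allFin-↭ σ))
    where
    relabel : map (act σ) (ys {n} {d}) ≡ map yv (map (σ ⟨$⟩ʳ_) (allFin d))
    relabel = trans (sym (List.map-∘ (allFin d))) (trans (List.map-cong (act-yv σ) (allFin d)) (List.map-∘ (allFin d)))

module _ {n d : ℕ} where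

  private
    P = Poly n d
    module R = CommutativeRing (polyRing n d)

  signP-cong : ∀ i {p q : P} → p ≋ q → signP i p ≋ signP i q
  signP-cong zero    p≋q = p≋q
  signP-cong (suc i) p≋q = R.-‿cong (signP-cong i p≋q)

  sumTo-cong : ∀ r {f g : ℕ → P} → (∀ i → f i ≋ g i) → sumTo r f ≋ sumTo r g
  sumTo-cong zero    f≋g = f≋g 0
  sumTo-cong (suc r) f≋g = R.+-cong (sumTo-cong r f≋g) (f≋g (suc r))

  InG-symmetric : ∀ {k} {g : P} → InG n k d g → Symmetric g
  InG-symmetric (genH r _) σ = ≋⇒≈ (R.trans (≡⇒≋ (act-hom σ r ys)) (hom-↭ (act-ys σ) r))
  InG-symmetric (genEH r _) σ = ≋⇒≈ (R.trans (≡⇒≋ (act-sumTo σ r _)) (sumTo-cong r term))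
    where
    term : ∀ i → act σ (signP i (elem (r ∸ i) xs *P hom i ys)) ≋ signP i (elem (r ∸ i) xs *P hom i ys)
    term i = begin
      act σ (signP i (elem (r ∸ i) xs *P hom i ys))
        ≡⟨ trans (act-signP σ i _) (cong (signP i) (act-*P σ (elem (r ∸ i) xs) (hom i ys))) ⟩
      signP i (act σ (elem (r ∸ i) xs) *P act σ (hom i ys))
        ≡⟨ cong₂ (λ e h → signP i (e *P h)) (trans (act-elem σ (r ∸ i) xs) (cong (elem (r ∸ i)) (act-xs σ))) (act-hom σ i ys) ⟩
      signP i (elem (r ∸ i) xs *P hom i (map (act σ) ys))
        ≈⟨ signP-cong i (R.*-congˡ {elem (r ∸ i) xs} (hom-↭ (act-ys σ) i)) ⟩
      signP i (elem (r ∸ i) xs *P hom i ys) ∎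
      where open SetoidReasoning R.setoid
  InG-symmetric (genX i) σ = ≋⇒≈ (R.trans (≡⇒≋ (act-sumTo σ d _)) (sumTo-cong d term))
    where
    term : ∀ j → act σ (signP j ((xv i ^P (d ∸ j)) *P elem j ys)) ≋ signP j ((xv i ^P (d ∸ j)) *P elem j ys)
    term j = begin
      act σ (signP j ((xv i ^P (d ∸ j)) *P elem j ys))
        ≡⟨ trans (act-signP σ j _) (cong (signP j) (act-*P σ (xv i ^P (d ∸ j)) (elem j ys))) ⟩
      signP j (act σ (xv i ^P (d ∸ j)) *P act σ (elem j ys))
        ≡⟨ cong₂ (λ x e → signP j (x *P e)) (trans (act-^P σ (xv i) (d ∸ j)) (cong (_^P (d ∸ j)) (act-xv σ i))) (act-elem σ j ys) ⟩
      signP j ((xv i ^P (d ∸ j)) *P elem j (map (act σ) ys))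
        ≈⟨ signP-cong j (R.*-congˡ {xv i ^P (d ∸ j)} (elem-↭ (act-ys σ) j)) ⟩
      signP j ((xv i ^P (d ∸ j)) *P elem j ys) ∎
      where open SetoidReasoning R.setoid

-- Enumerating 𝔖_d

module _ {k : ℕ} where

  insert-cong : ∀ (i j : Fin (suc k)) {π ρ : Permutation′ k} → π Perm.≈ ρ →
    Perm.insert i j π Perm.≈ Perm.insert i j ρ
  insert-cong i j π≈ρ x with i Fin.≟ x
  ... | yes _   = refl
  ... | no  i≢x = cong (punchIn j) (π≈ρ (punchOut i≢x))

  remove-cong : ∀ (i : Fin (suc k)) {π ρ : Permutation′ (suc k)} → π Perm.≈ ρ →
    Perm.remove i π Perm.≈ Perm.remove i ρ
  remove-cong i π≈ρ x = punchOut-cong₂ (π≈ρ i) (π≈ρ (punchIn i x))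
    where
    punchOut-cong₂ : ∀ {a a′ b b′ : Fin (suc k)} {a≢b : a ≢ b} {a′≢b′ : a′ ≢ b′} →
      a ≡ a′ → b ≡ b′ → punchOut a≢b ≡ punchOut a′≢b′
    punchOut-cong₂ {a} refl refl = Fin.punchOut-cong a refl

-- A permutation of suc k points is coded by the image of 0 together with the
-- permutation it induces on the remaining k points.
enumerate : ∀ k → Fin (k !) → Permutation′ k
enumerate zero    _ = Perm.id
enumerate (suc k) i = Perm.insert zero (proj₁ (remQuot {suc k} (k !) i)) (enumerate k (proj₂ (remQuot {suc k} (k !) i)))

index : ∀ k → Permutation′ k → Fin (k !)
index zero    _ = zero
index (suc k) σ = combine {suc k} {k !} (σ ⟨$⟩ʳ zero) (index k (Perm.remove zero σ))

index-cong : ∀ k {π ρ : Permutation′ k} → π Perm.≈ ρ → index k π ≡ index k ρ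
index-cong zero    π≈ρ = refl
index-cong (suc k) {π} {ρ} π≈ρ = cong₂ (combine {suc k} {k !}) (π≈ρ zero) (index-cong k (remove-cong zero {π} {ρ} π≈ρ))

enumerate-index : ∀ k (σ : Permutation′ k) → enumerate k (index k σ) Perm.≈ σ
enumerate-index zero    σ ()
enumerate-index (suc k) σ x = begin
  enumerate (suc k) (combine (σ ⟨$⟩ʳ zero) (index k σ₀)) ⟨$⟩ʳ x
    ≡⟨ cong (λ (j , i) → Perm.insert zero j (enumerate k i) ⟨$⟩ʳ x) (Fin.remQuot-combine (σ ⟨$⟩ʳ zero) (index k σ₀)) ⟩
  Perm.insert zero (σ ⟨$⟩ʳ zero) (enumerate k (index k σ₀)) ⟨$⟩ʳ x
    ≡⟨ insert-cong zero (σ ⟨$⟩ʳ zero) (enumerate-index k σ₀) x ⟩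
  Perm.insert zero (σ ⟨$⟩ʳ zero) σ₀ ⟨$⟩ʳ x
    ≡⟨ Perm.insert-remove zero σ x ⟩
  σ ⟨$⟩ʳ x ∎
  where
  open ≡-Reasoning
  σ₀ = Perm.remove zero σ

index-enumerate : ∀ k (i : Fin (k !)) → index k (enumerate k i) ≡ i
index-enumerate zero    zero = refl
index-enumerate (suc k) i = begin
  combine j (index k (Perm.remove zero (Perm.insert zero j (enumerate k i′))))
    ≡⟨ cong (combine j) (index-cong k (Perm.remove-insert zero j (enumerate k i′))) ⟩
  combine j (index k (enumerate k i′))
    ≡⟨ cong (combine j) (index-enumerate k i′) ⟩
  combine j i′
    ≡⟨ Fin.combine-remQuot {suc k} (k !) i ⟩
  i ∎
  where
  open ≡-Reasoning
  j  = proj₁ (remQuot {suc k} (k !) i)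
  i′ = proj₂ (remQuot {suc k} (k !) i)

translate : ∀ k → Permutation′ k → Permutation′ (k !)
translate k τ = Perm.permutation (shift τ) (shift (Perm.flip τ))
  (cancel (Perm.flip τ) τ (λ x → Perm.inverseʳ τ))
  (cancel τ (Perm.flip τ) (λ x → Perm.inverseˡ τ))
  where
  shift : Permutation′ k → Fin (k !) → Fin (k !)
  shift π i = index k (enumerate k i ∘ₚ π)
  cancel : ∀ π ρ → (∀ x → ρ ⟨$⟩ʳ (π ⟨$⟩ʳ x) ≡ x) → ∀ i → shift ρ (shift π i) ≡ i
  cancel π ρ ρπ≈id i = trans
    (index-cong k λ x → trans (cong (ρ ⟨$⟩ʳ_) (enumerate-index k (enumerate k i ∘ₚ π) x)) (ρπ≈id _))
    (index-enumerate k i)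

enumerate-translate : ∀ k τ i → enumerate k (translate k τ ⟨$⟩ʳ i) Perm.≈ enumerate k i ∘ₚ τ
enumerate-translate k τ i = enumerate-index k (enumerate k i ∘ₚ τ)

-- The Reynolds operator

module _ {n d : ℕ} where

  private
    P = Poly n d
    module R = CommutativeRing (polyRing n d)
    open SemiringSum R.semiring using (sum; sum-cong-≋; sum-permute; ∑-distrib-+; *-distribʳ-sum; sum-replicate-zero)

  pairing-scale : ∀ c (f : P) Φ → pairing (scale c f) Φ ≡ c *ℤ pairing f Φ
  pairing-scale c f Φ = begin
    pairing (const c *P f) Φ                               ≡⟨ pairing-*P (const c) f Φ ⟩
    c *ℤ pairing f (λ b → Φ (mulM unitM b)) +ℤ + 0         ≡⟨ ℤ.+-identityʳ _ ⟩
    c *ℤ pairing f (λ b → Φ (mulM unitM b))                ≡⟨ cong (c *ℤ_) (pairing-congʳ f (λ b → cong Φ (mulM-identityˡ b))) ⟩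
    c *ℤ pairing f Φ                                       ∎
    where open ≡-Reasoning

  sum-constant : ∀ N (f : P) → sum {N} (λ _ → f) ≋ scale (+ N) f
  sum-constant zero    f = ≋-by-pairing λ Φ → sym (trans (pairing-scale (+ 0) f Φ) (ℤ.*-zeroˡ (pairing f Φ)))
  sum-constant (suc N) f = R.trans (R.+-congˡ (sum-constant N f)) (≋-by-pairing λ Φ → begin
    pairing (f +P scale (+ N) f) Φ              ≡⟨ pairing-++ f (scale (+ N) f) Φ ⟩
    pairing f Φ +ℤ pairing (scale (+ N) f) Φ    ≡⟨ cong (pairing f Φ +ℤ_) (pairing-scale (+ N) f Φ) ⟩
    pairing f Φ +ℤ + N *ℤ pairing f Φ           ≡⟨ ℤ.suc-* (+ N) (pairing f Φ) ⟨
    + suc N *ℤ pairing f Φ                      ≡⟨ pairing-scale (+ suc N) f Φ ⟨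
    pairing (scale (+ suc N) f) Φ               ∎)
    where open ≡-Reasoning

  act-sum : ∀ τ {N} (f : Fin N → P) → act τ (sum f) ≡ sum (λ i → act τ (f i))
  act-sum τ {zero}  f = refl
  act-sum τ {suc N} f = trans (act-++ τ (f zero) (sum (λ i → f (suc i)))) (cong (act τ (f zero) ++_) (act-sum τ (λ i → f (suc i))))

  reynolds : P → P
  reynolds a = sum (λ i → act (enumerate d i) a)

  reynolds-symmetric : ∀ a → Symmetric (reynolds a)
  reynolds-symmetric a τ = ≋⇒≈ (begin
    act τ (reynolds a)                                     ≡⟨ act-sum τ (λ i → act (enumerate d i) a) ⟩
    sum (λ i → act τ (act (enumerate d i) a))              ≈⟨ sum-cong-≋ (λ i → ≡⇒≋ (act-enumerate i)) ⟩
    sum (λ i → act (enumerate d (translate d τ ⟨$⟩ʳ i)) a) ≈⟨ sum-permute (λ i → act (enumerate d i) a) (translate d τ) ⟨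
    reynolds a                                             ∎)
    where
    open SetoidReasoning R.setoid
    act-enumerate : ∀ i → act τ (act (enumerate d i) a) ≡ act (enumerate d (translate d τ ⟨$⟩ʳ i)) a
    act-enumerate i = trans (act-∘ₚ (enumerate d i) τ a)
      (sym (act-cong {σ = enumerate d (translate d τ ⟨$⟩ʳ i)} {enumerate d i ∘ₚ τ} (enumerate-translate d τ i) a))

  reynolds-cong : ∀ {p q : P} → p ≋ q → reynolds p ≋ reynolds q
  reynolds-cong p≋q = sum-cong-≋ (λ i → act-resp-≋ (enumerate d i) p≋q)

  reynolds-0P : reynolds 0P ≋ 0P
  reynolds-0P = sum-replicate-zero (d !)

  reynolds-+P : ∀ (p q : P) → reynolds (p +P q) ≋ reynolds p +P reynolds q
  reynolds-+P p q = R.trans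
    (sum-cong-≋ (λ i → ≡⇒≋ (act-++ (enumerate d i) p q)))
    (∑-distrib-+ (λ i → act (enumerate d i) p) (λ i → act (enumerate d i) q))

  reynolds-*P-symmetric : ∀ (a g : P) → Symmetric g → reynolds (a *P g) ≋ reynolds a *P g
  reynolds-*P-symmetric a g g-sym = R.trans
    (sum-cong-≋ λ i → R.trans (≡⇒≋ (act-*P (enumerate d i) a g))
                                (R.*-congˡ {act (enumerate d i) a} (mk≋ (g-sym (enumerate d i)))))
    (R.sym (*-distribʳ-sum g (λ i → act (enumerate d i) a)))

  reynolds-of-symmetric : ∀ (f : P) → Symmetric f → reynolds f ≋ scale (+ (d !)) f
  reynolds-of-symmetric f f-sym = R.trans (sum-cong-≋ (λ i → mk≋ (f-sym (enumerate d i)))) (sum-constant (d !) f)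

  combination : List (P × P) → P
  combination l = sumP (map (λ { (a , g) → a *P g }) l)

  reynolds-combination : ∀ {k} {Coef : P → Set} {l} → All (λ { (a , g) → Coef a × InG n k d g }) l →
    reynolds (combination l) ≋ combination (map (map₁ reynolds) l)
  reynolds-combination []                         = reynolds-0P
  reynolds-combination {l = (a , g) ∷ l} ((_ , g∈G) ∷ gens) = R.trans (reynolds-+P (a *P g) (combination l))
    (R.+-cong (reynolds-*P-symmetric a g (InG-symmetric g∈G)) (reynolds-combination gens))

  reynolds-coefficients : ∀ {k} {Coef : P → Set} {l} → All (λ { (a , g) → Coef a × InG n k d g }) l →
    All (λ { (a , g) → Symmetric a × InG n k d g }) (map (map₁ reynolds) l)
  reynolds-coefficients []                         = []
  reynolds-coefficients {l = (a , g) ∷ l} ((_ , g∈G) ∷ gens) = (reynolds-symmetric a , g∈G) ∷ reynolds-coefficients gens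

  reynolds-InIdealBy : ∀ {k} {Coef : P → Set} {f} → InIdealBy n k d Coef f → InIdealBy n k d Symmetric (reynolds f)
  reynolds-InIdealBy (l , gens , f≈) =
    map (map₁ reynolds) l , reynolds-coefficients gens , ≋⇒≈ (R.trans (reynolds-cong (mk≋ f≈)) (reynolds-combination gens))

InIdealBy-resp-≋ : ∀ {n k d Coef} {f f′ : Poly n d} → f ≋ f′ → InIdealBy n k d Coef f → InIdealBy n k d Coef f′
InIdealBy-resp-≋ (mk≋ f≈f′) (l , gens , f≈) = l , gens , λ m → trans (sym (f≈f′ m)) (f≈ m)

lemma4p10 : (n k d : ℕ) → 1 ≤ d → d ≤ k → k ≤ n →
    (f : Poly n d) → J n k d f → Symmetric f →
    InIdealBy n k d Symmetric (scale (+ (d !)) f)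
lemma4p10 n k d _ _ _ f f∈J f-sym =
  InIdealBy-resp-≋ (reynolds-of-symmetric f f-sym) (reynolds-InIdealBy f∈J)
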